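{- Let $A\subset(N,2N]$ be such that $L\le\tau(n)\le U$ for all $n\in A$. Then \[ \sum_{j:\,n_j\in A}\tau(n_j)\ll\frac{N}{L}\cdot U. \]
   Context: $\tau(n)$ is the number of positive divisors of $n$. The orbit is $n_0=x$, $n_{j+1}=n_j-\tau(n_j)$ for some starting integer $x$. -}

module Defs where

open import Data.Nat using (ℕ; zero; suc; _+_; _∸_)
open import Data.Nat.Divisibility using (_∣?_)
open import Data.List using (List; length; filter; map; upTo)
open import Data.Bool using (Bool; if_then_else_)

-- τ n = number of positive divisors of n, counted among 1..n.
-- (τ 0 = 0 by this convention; 0 is never in A, so it is irrelevant.)
τ : ℕ → ℕ
τ n = length (filter (λ d → d ∣? n) (map suc (upTo n)))

-- The orbit n_0 = x, n_{j+1} = n_j - τ(n_j).  For n ≥ 1, τ n ≤ n, so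
-- truncated subtraction is exact; once the orbit hits 0 it stays there.
orbit : ℕ → ℕ → ℕ
orbit x zero    = x
orbit x (suc j) = orbit x j ∸ τ (orbit x j)

orbitSum : (ℕ → Bool) → ℕ → ℕ → ℕ
orbitSum A x zero    = 0
orbitSum A x (suc M) =
  orbitSum A x M + (if A (orbit x M) then τ (orbit x M) else 0)

-- Along the orbit every step n ↦ n − τ(n) from a point of A lowers the orbit by
-- exactly τ(n), and the orbit never increases; since A lies below 2N, the
-- τ-values collected on A telescope to at most 2N.  Multiplying by L ≤ U (which
-- holds as soon as A is visited at all) gives the bound with constant 2.
module Submission where

open import Defs
open import Data.Nat using (ℕ; _*_; _≤_; _<_; _+_; _∸_; _⊓_; zero; suc; z≤n)
open import Data.Nat.Properties
open import Data.Nat.Divisibility using (_∣?_)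
open import Data.Bool using (Bool; true; false; if_then_else_)
open import Data.Product using (∃-syntax; _×_; _,_; proj₁; proj₂)
open import Data.Sum using (_⊎_; inj₁; inj₂)
open import Data.List using (length; map; upTo)
open import Data.List.Properties using (length-filter; length-map; length-upTo)
open import Relation.Binary.PropositionalEquality using (_≡_; refl; cong)

τ≤id : ∀ n → τ n ≤ n
τ≤id n = begin
  τ n                             ≤⟨ length-filter (_∣? n) (map suc (upTo n)) ⟩
  length (map suc (upTo n))       ≡⟨ length-map suc (upTo n) ⟩
  length (upTo n)                 ≡⟨ length-upTo n ⟩
  n                               ∎
  where open ≤-Reasoning

collected : (ℕ → Bool) → ℕ → ℕ
collected A n = if A n then τ n else 0

module _ (A : ℕ → Bool) (B : ℕ) (A≤B : ∀ n → A n ≡ true → n ≤ B) where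

  collected+step-⊓≤⊓ : ∀ n → collected A n + (n ∸ τ n) ⊓ B ≤ n ⊓ B
  collected+step-⊓≤⊓ n with A n in An
  ... | true = begin
    τ n + (n ∸ τ n) ⊓ B  ≤⟨ +-monoʳ-≤ (τ n) (m⊓n≤m (n ∸ τ n) B) ⟩
    τ n + (n ∸ τ n)      ≡⟨ m+[n∸m]≡n (τ≤id n) ⟩
    n                    ≡⟨ m≤n⇒m⊓n≡m (A≤B n An) ⟨
    n ⊓ B                ∎
    where open ≤-Reasoning
  ... | false = ⊓-monoˡ-≤ B (m∸n≤m n (τ n))

  orbitSum+orbit-⊓≤⊓ : ∀ x M → orbitSum A x M + orbit x M ⊓ B ≤ x ⊓ B
  orbitSum+orbit-⊓≤⊓ x zero = ≤-refl
  orbitSum+orbit-⊓≤⊓ x (suc M) = begin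
    s + collected A n + (n ∸ τ n) ⊓ B    ≡⟨ +-assoc s (collected A n) _ ⟩
    s + (collected A n + (n ∸ τ n) ⊓ B)  ≤⟨ +-monoʳ-≤ s (collected+step-⊓≤⊓ n) ⟩
    s + n ⊓ B                            ≤⟨ orbitSum+orbit-⊓≤⊓ x M ⟩
    x ⊓ B                                ∎
    where
    open ≤-Reasoning
    s = orbitSum A x M
    n = orbit x M

  orbitSum≤bound : ∀ x M → orbitSum A x M ≤ B
  orbitSum≤bound x M = begin
    orbitSum A x M                     ≤⟨ m≤m+n _ _ ⟩
    orbitSum A x M + orbit x M ⊓ B     ≤⟨ orbitSum+orbit-⊓≤⊓ x M ⟩
    x ⊓ B                              ≤⟨ m⊓n≤n x B ⟩
    B                                  ∎
    where open ≤-Reasoning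

orbitSum≡0⊎∃A : ∀ A x M → orbitSum A x M ≡ 0 ⊎ ∃[ n ] A n ≡ true
orbitSum≡0⊎∃A A x zero = inj₁ refl
orbitSum≡0⊎∃A A x (suc M) with A (orbit x M) in An | orbitSum≡0⊎∃A A x M
... | true  | _       = inj₂ (orbit x M , An)
... | false | inj₁ s≡0 = inj₁ (cong (_+ 0) s≡0)
... | false | inj₂ ∃A  = inj₂ ∃A

mainTheorem7 : ∃[ C ] (∀ (N L U : ℕ) (A : ℕ → Bool) (x : ℕ) →
    (∀ n → A n ≡ true → (N < n) × (n ≤ 2 * N)) →
    (∀ n → A n ≡ true → (L ≤ τ n) × (τ n ≤ U)) →
    1 ≤ L →
    ∀ M → orbitSum A x M * L ≤ C * N * U)
mainTheorem7 = 2 , bound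
  where
  bound : ∀ N L U A x → (∀ n → A n ≡ true → (N < n) × (n ≤ 2 * N)) →
          (∀ n → A n ≡ true → (L ≤ τ n) × (τ n ≤ U)) →
          1 ≤ L → ∀ M → orbitSum A x M * L ≤ 2 * N * U
  bound N L U A x A⊆interval τ-between _ M with orbitSum≡0⊎∃A A x M
  ... | inj₁ s≡0 rewrite s≡0 = z≤n
  ... | inj₂ (n , An) = *-mono-≤ orbitSum≤2N L≤U
    where
    orbitSum≤2N : orbitSum A x M ≤ 2 * N
    orbitSum≤2N = orbitSum≤bound A (2 * N) (λ m Am → proj₂ (A⊆interval m Am)) x M

    L≤U : L ≤ U
    L≤U = ≤-trans (proj₁ (τ-between n An)) (proj₂ (τ-between n An))
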